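{- For every integer $n\ge 0$, $$\sum_{j,k}\genfrac{[}{]}{0pt}{}{n}{k}\genfrac{\{}{\}}{0pt}{}{k}{j}\binom{n}{j}(-1)^k=(-1)^n .$$
   Context: Here $\genfrac{[}{]}{0pt}{}{n}{k}$ denotes the unsigned (absolute) Stirling number of the first kind and $\genfrac{\{}{\}}{0pt}{}{n}{k}$ the ordinary Stirling number of the second kind (Knuth's notation), with $\genfrac{[}{]}{0pt}{}{0}{0}=\genfrac{\{}{\}}{0pt}{}{0}{0}=1$, $\genfrac{[}{]}{0pt}{}{n}{0}=\genfrac{\{}{\}}{0pt}{}{n}{0}=0$ for $n>0$, and both vanish for $0\le n<k$. The double summation is over all integers $j,k$ with $0\le j\le k\le n$. -}

module Defs where

open import Data.Nat using (ℕ; zero; suc; _+_; _*_)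
open import Data.Integer using (ℤ; +_; -_) renaming (_+_ to _+ℤ_; _*_ to _*ℤ_)
open import Data.Nat.Combinatorics using (_C_)

stirling1 : ℕ → ℕ → ℕ
stirling1 zero    zero    = 1
stirling1 zero    (suc k) = 0
stirling1 (suc n) zero    = 0
stirling1 (suc n) (suc k) = n * stirling1 n (suc k) + stirling1 n k

stirling2 : ℕ → ℕ → ℕ
stirling2 zero    zero    = 1
stirling2 zero    (suc k) = 0
stirling2 (suc n) zero    = 0
stirling2 (suc n) (suc k) = suc k * stirling2 n (suc k) + stirling2 n k

sgn : ℕ → ℤ
sgn zero    = + 1
sgn (suc k) = - sgn k

sumTo : ℕ → (ℕ → ℤ) → ℤ
sumTo zero    f = f 0
sumTo (suc n) f = sumTo n f +ℤ f (suc n)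

term : ℕ → ℕ → ℕ → ℤ
term n j k = (+ (stirling1 n k * stirling2 k j * (n C j))) *ℤ sgn k

module Submission where

-- The Stirling numbers of the two kinds are inverse to each other
-- up to signs:  Σ_k (-1)^k [n k] {k j} = (-1)^n δ_{nj}  (orthogonality).
-- Granting this, swapping the two sums of the theorem gives
--   Σ_j C(n,j) Σ_k (-1)^k [n k] {k j} = Σ_j C(n,j) (-1)^n δ_{nj} = C(n,n) (-1)^n,
-- which is (-1)^n.

open import Defs
open import Data.Nat using (ℕ; zero; suc; _≤_; _<_; z≤n; s≤s)
import Data.Nat as ℕ
import Data.Nat.Properties as ℕ
open import Data.Nat.Combinatorics using (_C_; nCn≡1)
open import Data.Integer using (ℤ; +_; -_; _+_; _*_)
open import Data.Integer.Properties
  using (pos-+; pos-*; *-zeroˡ; *-zeroʳ; *-identityˡ; +-identityˡ; +-identityʳ; neg-distribˡ-*)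
open import Data.Integer.Tactic.RingSolver using (solve-∀)
open import Data.Sum using (_⊎_; inj₁; inj₂)
open import Data.Empty using (⊥-elim)
open import Relation.Binary.PropositionalEquality using (_≡_; refl; sym; trans; cong; cong₂)
open Relation.Binary.PropositionalEquality.≡-Reasoning

sumTo-cong : ∀ n {f g : ℕ → ℤ} → (∀ i → i ≤ n → f i ≡ g i) → sumTo n f ≡ sumTo n g
sumTo-cong zero    eq = eq 0 z≤n
sumTo-cong (suc n) eq =
  cong₂ _+_ (sumTo-cong n (λ i i≤n → eq i (ℕ.m≤n⇒m≤1+n i≤n))) (eq (suc n) ℕ.≤-refl)

sumTo-+ : ∀ n (f g : ℕ → ℤ) → sumTo n (λ i → f i + g i) ≡ sumTo n f + sumTo n g
sumTo-+ zero    f g = refl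
sumTo-+ (suc n) f g =
  trans (cong (_+ (f (suc n) + g (suc n))) (sumTo-+ n f g))
        (interchange (sumTo n f) (sumTo n g) (f (suc n)) (g (suc n)))
  where
  interchange : ∀ a b c d → (a + b) + (c + d) ≡ (a + c) + (b + d)
  interchange = solve-∀

sumTo-* : ∀ n c (f : ℕ → ℤ) → sumTo n (λ i → c * f i) ≡ c * sumTo n f
sumTo-* zero    c f = refl
sumTo-* (suc n) c f =
  trans (cong (_+ (c * f (suc n))) (sumTo-* n c f)) (factor c (sumTo n f) (f (suc n)))
  where
  factor : ∀ c a b → c * a + c * b ≡ c * (a + b)
  factor = solve-∀

sumTo-neg : ∀ n (f : ℕ → ℤ) → sumTo n (λ i → - f i) ≡ - sumTo n f
sumTo-neg zero    f = refl
sumTo-neg (suc n) f =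
  trans (cong (_+ - f (suc n)) (sumTo-neg n f)) (negate-+ (sumTo n f) (f (suc n)))
  where
  negate-+ : ∀ a b → - a + - b ≡ - (a + b)
  negate-+ = solve-∀

sumTo-shift : ∀ n (f : ℕ → ℤ) → sumTo (suc n) f ≡ f 0 + sumTo n (λ i → f (suc i))
sumTo-shift zero    f = refl
sumTo-shift (suc n) f =
  trans (cong (_+ f (suc (suc n))) (sumTo-shift n f))
        (reassociate (f 0) (sumTo n (λ i → f (suc i))) (f (suc (suc n))))
  where
  reassociate : ∀ a b c → (a + b) + c ≡ a + (b + c)
  reassociate = solve-∀

sumTo-swap : ∀ m p (F : ℕ → ℕ → ℤ) →
             sumTo m (λ k → sumTo p (F k)) ≡ sumTo p (λ j → sumTo m (λ k → F k j))
sumTo-swap zero    p F = refl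
sumTo-swap (suc m) p F =
  trans (cong (_+ sumTo p (F (suc m))) (sumTo-swap m p F))
        (sym (sumTo-+ p (λ j → sumTo m (λ k → F k j)) (F (suc m))))

sumTo-zero : ∀ n (f : ℕ → ℤ) → (∀ i → i ≤ n → f i ≡ + 0) → sumTo n f ≡ + 0
sumTo-zero n f f≡0 = trans (sumTo-cong n f≡0) (allZero n)
  where
  allZero : ∀ n → sumTo n (λ _ → + 0) ≡ + 0
  allZero zero    = refl
  allZero (suc n) = cong (_+ + 0) (allZero n)

sumTo-vanishingTail : ∀ {m} n (f : ℕ → ℤ) → m ≤ n →
                      (∀ i → m < i → f i ≡ + 0) → sumTo n f ≡ sumTo m f
sumTo-vanishingTail zero    f z≤n f≡0 = refl
sumTo-vanishingTail (suc n) f m≤1+n f≡0 with ℕ.m≤n⇒m<n∨m≡n m≤1+n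
... | inj₂ refl = refl
... | inj₁ (s≤s m≤n) = begin
  sumTo n f + f (suc n)  ≡⟨ cong (λ x → sumTo n f + x) (f≡0 (suc n) (s≤s m≤n)) ⟩
  sumTo n f + + 0        ≡⟨ +-identityʳ (sumTo n f) ⟩
  sumTo n f              ≡⟨ sumTo-vanishingTail n f m≤n f≡0 ⟩
  _                      ∎

sumTo-last : ∀ n (f : ℕ → ℤ) → (∀ i → i < n → f i ≡ + 0) → sumTo n f ≡ f n
sumTo-last zero    f f≡0 = refl
sumTo-last (suc n) f f≡0 =
  trans (cong (_+ f (suc n)) (sumTo-zero n f (λ i i≤n → f≡0 i (s≤s i≤n))))
        (+-identityˡ (f (suc n)))

stirling1-vanish : ∀ {n k} → n < k → stirling1 n k ≡ 0
stirling1-vanish {zero}  {suc k} _         = refl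
stirling1-vanish {suc n} {suc k} (s≤s n<k) =
  trans (cong₂ (λ a b → n ℕ.* a ℕ.+ b) (stirling1-vanish (ℕ.m<n⇒m<1+n n<k)) (stirling1-vanish n<k))
        (trans (ℕ.+-identityʳ (n ℕ.* 0)) (ℕ.*-zeroʳ n))

stirling2-vanish : ∀ {n k} → n < k → stirling2 n k ≡ 0
stirling2-vanish {zero}  {suc k} _         = refl
stirling2-vanish {suc n} {suc k} (s≤s n<k) =
  trans (cong₂ (λ a b → suc k ℕ.* a ℕ.+ b) (stirling2-vanish (ℕ.m<n⇒m<1+n n<k)) (stirling2-vanish n<k))
        (trans (ℕ.+-identityʳ (suc k ℕ.* 0)) (ℕ.*-zeroʳ (suc k)))

stirling1Left : ℕ → ℕ → ℕ
stirling1Left n zero    = 0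
stirling1Left n (suc k) = stirling1 n k

stirling1-rec : ∀ n k → stirling1 (suc n) k ≡ n ℕ.* stirling1 n k ℕ.+ stirling1Left n k
stirling1-rec n (suc k) = refl
stirling1-rec n zero    = sym (trans (ℕ.+-identityʳ (n ℕ.* stirling1 n 0)) (row0 n))
  where
  row0 : ∀ n → n ℕ.* stirling1 n 0 ≡ 0
  row0 zero    = refl
  row0 (suc n) = ℕ.*-zeroʳ (suc n)

transform : ℕ → (ℕ → ℤ) → ℤ
transform n c = sumTo n (λ k → sgn k * (+ stirling1 n k * c k))

transform-linear : ∀ n a (f g : ℕ → ℤ) →
                   transform n (λ k → a * f k + g k) ≡ a * transform n f + transform n g
transform-linear n a f g = begin
  transform n (λ k → a * f k + g k)
    ≡⟨ sumTo-cong n (λ k _ → distribute (sgn k) (+ stirling1 n k) a (f k) (g k)) ⟩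
  sumTo n (λ k → a * (sgn k * (+ stirling1 n k * f k)) + sgn k * (+ stirling1 n k * g k))
    ≡⟨ sumTo-+ n _ _ ⟩
  sumTo n (λ k → a * (sgn k * (+ stirling1 n k * f k))) + transform n g
    ≡⟨ cong (_+ transform n g) (sumTo-* n a _) ⟩
  a * transform n f + transform n g ∎
  where
  distribute : ∀ s x a u v → s * (x * (a * u + v)) ≡ a * (s * (x * u)) + s * (x * v)
  distribute = solve-∀

transform-zero : ∀ n → transform n (λ _ → + 0) ≡ + 0
transform-zero n =
  sumTo-zero n _ (λ k _ → trans (cong (sgn k *_) (*-zeroʳ (+ stirling1 n k))) (*-zeroʳ (sgn k)))

transform-step : ∀ n (c : ℕ → ℤ) →
                 transform (suc n) c ≡ + n * transform n c + - transform n (λ k → c (suc k))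
transform-step n c = begin
  transform (suc n) c
    ≡⟨ sumTo-cong (suc n) (λ k _ → splitTerm k) ⟩
  sumTo (suc n) (λ k → + n * row k + left k)
    ≡⟨ sumTo-+ (suc n) _ _ ⟩
  sumTo (suc n) (λ k → + n * row k) + sumTo (suc n) left
    ≡⟨ cong₂ _+_ (sumTo-* (suc n) (+ n) row) (sumTo-shift n left) ⟩
  + n * sumTo (suc n) row + (left 0 + sumTo n (λ k → left (suc k)))
    ≡⟨ cong₂ (λ a b → + n * a + b) dropLastRow
             (trans (cong (_+ sumTo n (λ k → left (suc k))) leftHead)
                    (+-identityˡ (sumTo n (λ k → left (suc k))))) ⟩
  + n * transform n c + sumTo n (λ k → left (suc k))
    ≡⟨ cong (λ x → + n * transform n c + x)
            (trans (sumTo-cong n (λ k _ → sym (neg-distribˡ-* (sgn k) (+ stirling1 n k * c (suc k)))))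
                   (sumTo-neg n (λ k → sgn k * (+ stirling1 n k * c (suc k))))) ⟩
  + n * transform n c + - transform n (λ k → c (suc k)) ∎
  where
  row left : ℕ → ℤ
  row  k = sgn k * (+ stirling1 n k * c k)
  left k = sgn k * (+ stirling1Left n k * c k)

  splitTerm : ∀ k → sgn k * (+ stirling1 (suc n) k * c k) ≡ + n * row k + left k
  splitTerm k = begin
    sgn k * (+ stirling1 (suc n) k * c k)
      ≡⟨ cong (λ x → sgn k * (+ x * c k)) (stirling1-rec n k) ⟩
    sgn k * (+ (n ℕ.* stirling1 n k ℕ.+ stirling1Left n k) * c k)
      ≡⟨ cong (λ x → sgn k * (x * c k))
              (trans (pos-+ (n ℕ.* stirling1 n k) (stirling1Left n k))
                     (cong (_+ + stirling1Left n k) (pos-* n (stirling1 n k)))) ⟩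
    sgn k * ((+ n * + stirling1 n k + + stirling1Left n k) * c k)
      ≡⟨ distribute (sgn k) (+ n) (+ stirling1 n k) (+ stirling1Left n k) (c k) ⟩
    + n * row k + left k ∎
    where
    distribute : ∀ s a x y u → s * ((a * x + y) * u) ≡ a * (s * (x * u)) + s * (y * u)
    distribute = solve-∀

  dropLastRow : sumTo (suc n) row ≡ transform n c
  dropLastRow = sumTo-vanishingTail (suc n) row (ℕ.n≤1+n n) rowVanishes
    where
    rowVanishes : ∀ k → n < k → row k ≡ + 0
    rowVanishes k n<k = trans (cong (λ x → sgn k * (+ x * c k)) (stirling1-vanish n<k))
                              (*-zeroʳ (sgn k))

  leftHead : left 0 ≡ + 0
  leftHead = cong (+ 1 *_) (*-zeroˡ (c 0))

δ : ℕ → ℕ → ℤ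
δ zero    zero    = + 1
δ zero    (suc j) = + 0
δ (suc n) zero    = + 0
δ (suc n) (suc j) = - δ n j

δ-support : ∀ n j → δ n j ≡ + 0 ⊎ n ≡ j
δ-support zero    zero    = inj₂ refl
δ-support zero    (suc j) = inj₁ refl
δ-support (suc n) zero    = inj₁ refl
δ-support (suc n) (suc j) with δ-support n j
... | inj₁ δ≡0 = inj₁ (cong -_ δ≡0)
... | inj₂ n≡j = inj₂ (cong suc n≡j)

δ-diagonal : ∀ n → δ n n ≡ sgn n
δ-diagonal zero    = refl
δ-diagonal (suc n) = cong -_ (δ-diagonal n)

δ-scale : ∀ n j → + n * δ n j ≡ + j * δ n j
δ-scale n j with δ-support n j
... | inj₁ δ≡0 rewrite δ≡0 = trans (*-zeroʳ (+ n)) (sym (*-zeroʳ (+ j)))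
... | inj₂ refl = refl

sumTo-δ : ∀ n (c : ℕ → ℤ) → sumTo n (λ j → c j * δ n j) ≡ c n * sgn n
sumTo-δ n c = trans (sumTo-last n _ offDiagonal) (cong (c n *_) (δ-diagonal n))
  where
  offDiagonal : ∀ j → j < n → c j * δ n j ≡ + 0
  offDiagonal j j<n with δ-support n j
  ... | inj₁ δ≡0 = trans (cong (c j *_) δ≡0) (*-zeroʳ (c j))
  ... | inj₂ refl = ⊥-elim (ℕ.<-irrefl refl j<n)

column : ℕ → ℕ → ℤ
column j k = + stirling2 k j

orthogonality : ∀ n j → transform n (column j) ≡ δ n j
orthogonality zero    zero    = refl
orthogonality zero    (suc j) = refl
orthogonality (suc n) zero    = begin
  transform (suc n) (column 0)
    ≡⟨ transform-step n (column 0) ⟩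
  + n * transform n (column 0) + - transform n (λ _ → + 0)
    ≡⟨ cong₂ (λ a b → + n * a + - b) (orthogonality n 0) (transform-zero n) ⟩
  + n * δ n 0 + - + 0
    ≡⟨ cong (_+ - + 0) (δ-scale n 0) ⟩
  + 0 ∎
orthogonality (suc n) (suc j) = begin
  transform (suc n) (column (suc j))
    ≡⟨ transform-step n (column (suc j)) ⟩
  + n * transform n (column (suc j)) + - transform n (λ k → column (suc j) (suc k))
    ≡⟨ cong (λ t → + n * transform n (column (suc j)) + - t)
            (trans (sumTo-cong n (λ k _ → cong (λ x → sgn k * (+ stirling1 n k * x)) (columnRec k)))
                   (transform-linear n (+ suc j) (column (suc j)) (column j))) ⟩
  + n * transform n (column (suc j)) + - (+ suc j * transform n (column (suc j)) + transform n (column j))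
    ≡⟨ cong₂ (λ a b → + n * a + - (+ suc j * a + b)) (orthogonality n (suc j)) (orthogonality n j) ⟩
  + n * δ n (suc j) + - (+ suc j * δ n (suc j) + δ n j)
    ≡⟨ cong (_+ - (+ suc j * δ n (suc j) + δ n j)) (δ-scale n (suc j)) ⟩
  + suc j * δ n (suc j) + - (+ suc j * δ n (suc j) + δ n j)
    ≡⟨ cancel (+ suc j * δ n (suc j)) (δ n j) ⟩
  - δ n j ∎
  where
  columnRec : ∀ k → column (suc j) (suc k) ≡ + suc j * column (suc j) k + column j k
  columnRec k = trans (pos-+ (suc j ℕ.* stirling2 k (suc j)) (stirling2 k j))
                      (cong (_+ column j k) (pos-* (suc j) (stirling2 k (suc j))))

  cancel : ∀ x y → x + - (x + y) ≡ - y
  cancel = solve-∀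

term-factor : ∀ n j k → term n j k ≡ + (n C j) * (sgn k * (+ stirling1 n k * column j k))
term-factor n j k = begin
  + (stirling1 n k ℕ.* stirling2 k j ℕ.* (n C j)) * sgn k
    ≡⟨ cong (_* sgn k) (trans (pos-* (stirling1 n k ℕ.* stirling2 k j) (n C j))
                              (cong (_* + (n C j)) (pos-* (stirling1 n k) (stirling2 k j)))) ⟩
  + stirling1 n k * column j k * + (n C j) * sgn k
    ≡⟨ rearrange (+ stirling1 n k) (column j k) (+ (n C j)) (sgn k) ⟩
  + (n C j) * (sgn k * (+ stirling1 n k * column j k)) ∎
  where
  rearrange : ∀ x y c s → x * y * c * s ≡ c * (s * (x * y))
  rearrange = solve-∀

term-vanish : ∀ n j k → k < j → term n j k ≡ + 0
term-vanish n j k k<j = begin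
  term n j k                                           ≡⟨ term-factor n j k ⟩
  + (n C j) * (sgn k * (+ stirling1 n k * + stirling2 k j))
    ≡⟨ cong (λ x → + (n C j) * (sgn k * (+ stirling1 n k * + x))) (stirling2-vanish k<j) ⟩
  + (n C j) * (sgn k * (+ stirling1 n k * + 0))
    ≡⟨ cong (λ x → + (n C j) * (sgn k * x)) (*-zeroʳ (+ stirling1 n k)) ⟩
  + (n C j) * (sgn k * + 0)
    ≡⟨ cong (+ (n C j) *_) (*-zeroʳ (sgn k)) ⟩
  + (n C j) * + 0                                      ≡⟨ *-zeroʳ (+ (n C j)) ⟩
  + 0                                                  ∎

columnSum : ∀ n j → sumTo n (λ k → term n j k) ≡ + (n C j) * δ n j
columnSum n j = begin
  sumTo n (λ k → term n j k)      ≡⟨ sumTo-cong n (λ k _ → term-factor n j k) ⟩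
  sumTo n (λ k → + (n C j) * _)   ≡⟨ sumTo-* n (+ (n C j)) _ ⟩
  + (n C j) * transform n (column j) ≡⟨ cong (+ (n C j) *_) (orthogonality n j) ⟩
  + (n C j) * δ n j               ∎

mainTheorem2 : (n : ℕ) → sumTo n (λ k → sumTo k (λ j → term n j k)) ≡ sgn n
mainTheorem2 n = begin
  sumTo n (λ k → sumTo k (λ j → term n j k))
    ≡⟨ sumTo-cong n (λ k k≤n → sym (sumTo-vanishingTail n (λ j → term n j k) k≤n (λ j → term-vanish n j k))) ⟩
  sumTo n (λ k → sumTo n (λ j → term n j k))
    ≡⟨ sumTo-swap n n (λ k j → term n j k) ⟩
  sumTo n (λ j → sumTo n (λ k → term n j k))
    ≡⟨ sumTo-cong n (λ j _ → columnSum n j) ⟩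
  sumTo n (λ j → + (n C j) * δ n j)
    ≡⟨ sumTo-δ n (λ j → + (n C j)) ⟩
  + (n C n) * sgn n
    ≡⟨ cong (λ c → + c * sgn n) (nCn≡1 n) ⟩
  + 1 * sgn n
    ≡⟨ *-identityˡ (sgn n) ⟩
  sgn n ∎
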